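{- Let $f:\mathbb{F}_2^d\to\mathbb{F}_2$ be $k$-th order sensitive at the point $\mathbf{y}=(y_1,\dots,y_d)$ and have real polynomial degree $p$. Define $\mathbf{y}^1=\mathbf{y}$ and, for $i\ge2$, $\mathbf{y}^i\in\mathbb{F}_2^{d^i}$ as the concatenation of $d$ copies of $\mathbf{y}^{i-1}$. Define $f^1=f$ and, for $i\ge 2$, $f^i:\mathbb{F}_2^{d^i}\to\mathbb{F}_2$ by $f^i(x_1,\dots,x_{d^i})=f(z_1,\dots,z_d)$ where, for $1\le j\le d$, $z_j=f^{i-1}(x_{(j-1)d^{i-1}+1},\dots,x_{jd^{i-1}})\oplus f^{i-1}(\mathbf{y}^{i-1})\oplus y_j$. Then for every $u\ge1$, $f^u$ is a function on $n=d^u$ variables which is $k$-th order sensitive at the point $\mathbf{y}^u$, and $\mathrm{pdeg}(f^u)=p^u$.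
   Context: $\mathrm{pdeg}(h)$ denotes the real polynomial degree of a Boolean function $h$, i.e. the degree of the unique multilinear real polynomial agreeing with $h$ on $\{0,1\}^n$. For $S\subseteq[n]$, $\mathbf{x}^{(S)}$ is $\mathbf{x}$ with the bits in $S$ flipped. A function $h$ is $k$-th order sensitive at $\mathbf{x}$ if $h(\mathbf{x})\ne h(\mathbf{x}^{(S)})$ for all $S\subseteq[n]$ with $1\le|S|\le k$. -}

module Defs where

open import Data.Nat using (ℕ; zero; suc; _^_; _≤_; NonZero)
open import Data.Bool using (Bool; true; false; _xor_; if_then_else_)
open import Data.Fin using (Fin; zero; suc; combine; remQuot)
open import Data.Fin.Subset using (Subset; ∣_∣)
open import Data.Vec using (Vec; []; _∷_; lookup)
open import Data.List using (List; []; _∷_; map; _++_)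
open import Data.Integer using (ℤ; _*_; _+_; 0ℤ; 1ℤ)
open import Data.Product using (_×_; proj₁; proj₂; ∃)
open import Relation.Binary.PropositionalEquality using (_≡_; _≢_)
open import Function using (_∘_)

Point : ℕ → Set
Point n = Fin n → Bool

BoolFun : ℕ → Set
BoolFun n = Point n → Bool

flipAt : ∀ {n} → Subset n → Point n → Point n
flipAt S x i = x i xor lookup S i

KSensitive : ∀ {n} → ℕ → BoolFun n → Point n → Set
KSensitive {n} k h x =
  (S : Subset n) → 1 ≤ ∣ S ∣ → ∣ S ∣ ≤ k → h x ≢ h (flipAt S x)

-- Multilinear polynomials in n variables: a coefficient for each monomial
-- (monomials indexed by subsets of the variables). Integer coefficients
-- (the unique real multilinear representation of a Boolean
-- function has integer coefficients).
MultilinearPoly : ℕ → Set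
MultilinearPoly n = Subset n → ℤ

allSubsets : (n : ℕ) → List (Subset n)
allSubsets zero = [] ∷ []
allSubsets (suc n) = map (false ∷_) (allSubsets n) ++ map (true ∷_) (allSubsets n)

b2z : Bool → ℤ
b2z true = 1ℤ
b2z false = 0ℤ

monomial : ∀ {n} → Subset n → Point n → ℤ
monomial [] x = 1ℤ
monomial (b ∷ S) x = (if b then b2z (x zero) else 1ℤ) * monomial S (x ∘ suc)

sumℤ : List ℤ → ℤ
sumℤ [] = 0ℤ
sumℤ (a ∷ as) = a + sumℤ as

evalPoly : ∀ {n} → MultilinearPoly n → Point n → ℤ
evalPoly {n} c x = sumℤ (map (λ S → c S * monomial S x) (allSubsets n))

Represents : ∀ {n} → MultilinearPoly n → BoolFun n → Set
Represents c h = ∀ x → evalPoly c x ≡ b2z (h x)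

PolyDegree : ∀ {n} → MultilinearPoly n → ℕ → Set
PolyDegree {n} c p =
  ((S : Subset n) → c S ≢ 0ℤ → ∣ S ∣ ≤ p) × ∃ λ (S : Subset n) → (c S ≢ 0ℤ) × (∣ S ∣ ≡ p)

PDeg : ∀ {n} → BoolFun n → ℕ → Set
PDeg {n} h p = ∃ λ (c : MultilinearPoly n) → Represents c h × PolyDegree c p

-- For u = 1, Fin (d ^ 1) = Fin (d * 1) is identified with Fin d via the
-- canonical bijection remQuot/combine (index j ↦ j), so y^1 = y and f^1 = f.

-- The iterated point y^u ∈ F_2^(d^u), u ≥ 1.
-- Index combine j t (j : Fin d, t : Fin (d^(u-1))) is position (j-1)d^(u-1)+t
-- (1-based), i.e. the t-th bit of the j-th block.
yIter : ∀ {d} → Point d → (u : ℕ) → .{{NonZero u}} → Point (d ^ u)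
yIter {d} y (suc zero) = λ i → y (remQuot {d} 1 i .proj₁)
yIter {d} y (suc (suc i)) k = yIter y (suc i) (remQuot {d} (d ^ suc i) k .proj₂)

fIter : ∀ {d} → BoolFun d → Point d → (u : ℕ) → .{{NonZero u}} → BoolFun (d ^ u)
fIter {d} f y (suc zero) x = f (λ j → x (combine {d} {1} j zero))
fIter {d} f y (suc (suc i)) x =
  f (λ j → (fIter f y (suc i) (x ∘ combine {d} {d ^ suc i} j) xor fIter f y (suc i) (yIter y (suc i))) xor y j)

-- f^(u+1) is the block composition of f with the inner functions
-- a_j = f^u ⊕ f^u(y^u) ⊕ y_j on d disjoint blocks of variables.
--
-- Degree: substituting polynomials A_j of the a_j for the variables of a
-- polynomial F of f gives a polynomial of the composition of degree at most
-- deg F · max deg A_j. If R* is a top monomial of F and U a common top monomial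
-- of the A_j, the monomial spread R* U (a copy of U in each block j ∈ R*) has
-- coefficient F(R*) · ∏_{j ∈ R*} A_j(U) ≠ 0: any other R contributing to it
-- would strictly contain R*, hence have F(R) = 0. Negating f^u only changes
-- the constant term, so all A_j share the top monomials of f^u.
--
-- Sensitivity: a_j takes the value y_j on its block of y^(u+1), and flips
-- whenever at most k bits of its block are flipped, because f^u is k-th order
-- sensitive at y^u. Flipping a set S of at most k bits of y^(u+1) therefore
-- flips exactly the inputs of f indexed by the blocks S meets: a nonempty set
-- of at most k coordinates, so the value of f changes.

module Submission where

open import Defs
open import Algebra.Properties.CommutativeSemigroup using (interchange)
open import Data.Bool using (Bool; true; false; not; _∨_; _xor_; if_then_else_)
open import Data.Bool.Properties
  using (xor-identityʳ; xor-same; xor-assoc; xor-comm; xor-inverseˡ; ∨-identityʳ; ¬-not)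
open import Data.Empty using (⊥-elim)
open import Data.Fin using (Fin; zero; suc; combine; _↑ˡ_; _↑ʳ_)
open import Data.Fin.Properties using (remQuot-combine)
open import Data.Fin.Subset using (Subset; ∣_∣; _∈_; _⊆_; inside; outside) renaming (⊥ to ∅)
open import Data.Fin.Subset.Properties
  using (∣⊥∣≡0; drop-∷-⊆; out⊆; s⊆s; p⊆q⇒∣p∣≤∣q∣; x∈p⇒∣p-x∣<∣p∣)
open import Data.Integer using (ℤ; _+_; _*_; _-_; -_; 0ℤ; 1ℤ)
import Data.Integer.Properties as ℤ
open import Data.List using (List; []; _∷_; map) renaming (_++_ to _++ᴸ_)
open import Data.Nat as ℕ using (ℕ; zero; suc; _^_; _≤_; z≤n; s≤s; NonZero)
import Data.Nat.Properties as ℕ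
open import Data.Product using (_×_; _,_; proj₁; proj₂; ∃)
open import Data.Sum using (inj₁; inj₂)
open import Data.Vec using (Vec; []; _∷_; here; there; lookup; _++_; take; drop)
open import Data.Vec.Properties using (take++drop≡id; ++-injective; ∷-injectiveʳ; lookup-++ˡ; lookup-++ʳ; lookup-replicate)
open import Function using (_∘_)
open import Relation.Nullary using (yes; no; contradiction)
open import Relation.Binary.PropositionalEquality

open ≡-Reasoning

∑ : {A : Set} → List A → (A → ℤ) → ℤ
∑ xs f = sumℤ (map f xs)

syntax ∑ xs (λ x → e) = ∑[ x ← xs ] e

module _ {A : Set} where

  ∑-++ : (xs ys : List A) (f : A → ℤ) → ∑ (xs ++ᴸ ys) f ≡ ∑ xs f + ∑ ys f
  ∑-++ []       ys f = sym (ℤ.+-identityˡ _)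
  ∑-++ (x ∷ xs) ys f = trans (cong (f x +_) (∑-++ xs ys f)) (sym (ℤ.+-assoc (f x) _ _))

  ∑-cong : (xs : List A) {f g : A → ℤ} → (∀ a → f a ≡ g a) → ∑ xs f ≡ ∑ xs g
  ∑-cong []       f≗g = refl
  ∑-cong (x ∷ xs) f≗g = cong₂ _+_ (f≗g x) (∑-cong xs f≗g)

  ∑-+ : (xs : List A) (f g : A → ℤ) → ∑[ a ← xs ] (f a + g a) ≡ ∑ xs f + ∑ xs g
  ∑-+ []       f g = refl
  ∑-+ (x ∷ xs) f g =
    trans (cong (f x + g x +_) (∑-+ xs f g)) (interchange ℤ.+-commutativeSemigroup (f x) (g x) _ _)

  ∑-neg : (xs : List A) (f : A → ℤ) → ∑[ a ← xs ] (- f a) ≡ - ∑ xs f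
  ∑-neg []       f = refl
  ∑-neg (x ∷ xs) f = trans (cong (- f x +_) (∑-neg xs f)) (sym (ℤ.neg-distrib-+ (f x) _))

  ∑-*ˡ : (xs : List A) (c : ℤ) (f : A → ℤ) → ∑[ a ← xs ] (c * f a) ≡ c * ∑ xs f
  ∑-*ˡ []       c f = sym (ℤ.*-zeroʳ c)
  ∑-*ˡ (x ∷ xs) c f = trans (cong (c * f x +_) (∑-*ˡ xs c f)) (sym (ℤ.*-distribˡ-+ c (f x) _))

  ∑-*ʳ : (xs : List A) (c : ℤ) (f : A → ℤ) → ∑[ a ← xs ] (f a * c) ≡ ∑ xs f * c
  ∑-*ʳ []       c f = refl
  ∑-*ʳ (x ∷ xs) c f = trans (cong (f x * c +_) (∑-*ʳ xs c f)) (sym (ℤ.*-distribʳ-+ c (f x) _))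

  ∑-zero : (xs : List A) {f : A → ℤ} → (∀ a → f a ≡ 0ℤ) → ∑ xs f ≡ 0ℤ
  ∑-zero []       f≗0 = refl
  ∑-zero (x ∷ xs) f≗0 = cong₂ _+_ (f≗0 x) (∑-zero xs f≗0)

  ∑≢0⇒∃≢0 : (xs : List A) (f : A → ℤ) → ∑ xs f ≢ 0ℤ → ∃ λ a → f a ≢ 0ℤ
  ∑≢0⇒∃≢0 []       f ∑≢0 = ⊥-elim (∑≢0 refl)
  ∑≢0⇒∃≢0 (x ∷ xs) f ∑≢0 with f x ℤ.≟ 0ℤ
  ... | no  fx≢0 = x , fx≢0
  ... | yes fx≡0 = ∑≢0⇒∃≢0 xs f (λ ∑≡0 → ∑≢0 (cong₂ _+_ fx≡0 ∑≡0))

∑-map : {A B : Set} (g : A → B) (xs : List A) (f : B → ℤ) → ∑ (map g xs) f ≡ ∑ xs (f ∘ g)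
∑-map g []       f = refl
∑-map g (x ∷ xs) f = cong (f (g x) +_) (∑-map g xs f)

∑-comm : {A B : Set} (xs : List A) (ys : List B) (h : A → B → ℤ) →
  ∑[ a ← xs ] ∑[ b ← ys ] h a b ≡ ∑[ b ← ys ] ∑[ a ← xs ] h a b
∑-comm []       ys h = sym (∑-zero ys (λ _ → refl))
∑-comm (x ∷ xs) ys h = trans (cong (∑ ys (h x) +_) (∑-comm xs ys h)) (sym (∑-+ ys (h x) _))

∑-allSubsets-suc : ∀ n (F : Subset (suc n) → ℤ) →
  ∑ (allSubsets (suc n)) F ≡ ∑ (allSubsets n) (F ∘ (false ∷_)) + ∑ (allSubsets n) (F ∘ (true ∷_))
∑-allSubsets-suc n F = begin
  ∑ (map (false ∷_) (allSubsets n) ++ᴸ map (true ∷_) (allSubsets n)) F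
    ≡⟨ ∑-++ (map (false ∷_) (allSubsets n)) _ F ⟩
  ∑ (map (false ∷_) (allSubsets n)) F + ∑ (map (true ∷_) (allSubsets n)) F
    ≡⟨ cong₂ _+_ (∑-map _ (allSubsets n) F) (∑-map _ (allSubsets n) F) ⟩
  ∑ (allSubsets n) (F ∘ (false ∷_)) + ∑ (allSubsets n) (F ∘ (true ∷_)) ∎

∑-allSubsets-++ : ∀ m n (F : Subset (m ℕ.+ n) → ℤ) →
  ∑ (allSubsets (m ℕ.+ n)) F ≡ ∑[ S ← allSubsets m ] ∑[ T ← allSubsets n ] F (S ++ T)
∑-allSubsets-++ zero    n F = sym (ℤ.+-identityʳ _)
∑-allSubsets-++ (suc m) n F = begin
  ∑ (allSubsets (suc m ℕ.+ n)) F
    ≡⟨ ∑-allSubsets-suc (m ℕ.+ n) F ⟩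
  ∑ (allSubsets (m ℕ.+ n)) (F ∘ (false ∷_)) + ∑ (allSubsets (m ℕ.+ n)) (F ∘ (true ∷_))
    ≡⟨ cong₂ _+_ (∑-allSubsets-++ m n _) (∑-allSubsets-++ m n _) ⟩
  ∑[ S ← allSubsets m ] ∑[ T ← allSubsets n ] F (false ∷ S ++ T)
    + ∑[ S ← allSubsets m ] ∑[ T ← allSubsets n ] F (true ∷ S ++ T)
    ≡⟨ ∑-allSubsets-suc m _ ⟨
  ∑[ S ← allSubsets (suc m) ] ∑[ T ← allSubsets n ] F (S ++ T) ∎

∑-allSubsets-single : ∀ n (F : Subset n → ℤ) (S* : Subset n) →
  (∀ S → S ≢ S* → F S ≡ 0ℤ) → ∑ (allSubsets n) F ≡ F S*
∑-allSubsets-single zero    F []          others = ℤ.+-identityʳ _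
∑-allSubsets-single (suc n) F (false ∷ S*) others = begin
  ∑ (allSubsets (suc n)) F
    ≡⟨ ∑-allSubsets-suc n F ⟩
  ∑ (allSubsets n) (F ∘ (false ∷_)) + ∑ (allSubsets n) (F ∘ (true ∷_))
    ≡⟨ cong₂ _+_ (∑-allSubsets-single n _ S* (λ S S≢S* → others (false ∷ S) (S≢S* ∘ ∷-injectiveʳ)))
                 (∑-zero (allSubsets n) (λ S → others (true ∷ S) λ ())) ⟩
  F (false ∷ S*) + 0ℤ
    ≡⟨ ℤ.+-identityʳ _ ⟩
  F (false ∷ S*) ∎
∑-allSubsets-single (suc n) F (true ∷ S*)  others = begin
  ∑ (allSubsets (suc n)) F
    ≡⟨ ∑-allSubsets-suc n F ⟩
  ∑ (allSubsets n) (F ∘ (false ∷_)) + ∑ (allSubsets n) (F ∘ (true ∷_))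
    ≡⟨ cong₂ _+_ (∑-zero (allSubsets n) (λ S → others (false ∷ S) λ ()))
                 (∑-allSubsets-single n _ S* (λ S S≢S* → others (true ∷ S) (S≢S* ∘ ∷-injectiveʳ))) ⟩
  0ℤ + F (true ∷ S*)
    ≡⟨ ℤ.+-identityˡ _ ⟩
  F (true ∷ S*) ∎

-- Multilinear polynomials

monomial-cong : ∀ {n} (S : Subset n) {x x′ : Point n} → (∀ i → x i ≡ x′ i) → monomial S x ≡ monomial S x′
monomial-cong []      x≗x′ = refl
monomial-cong (b ∷ S) x≗x′ =
  cong₂ _*_ (cong (λ v → if b then b2z v else 1ℤ) (x≗x′ zero)) (monomial-cong S (x≗x′ ∘ suc))

evalPoly-cong : ∀ {n} (c : MultilinearPoly n) {x x′ : Point n} → (∀ i → x i ≡ x′ i) → evalPoly c x ≡ evalPoly c x′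
evalPoly-cong {n} c x≗x′ = ∑-cong (allSubsets n) (λ S → cong (c S *_) (monomial-cong S x≗x′))

b2z-injective : ∀ {a b} → b2z a ≡ b2z b → a ≡ b
b2z-injective {false} {false} _ = refl
b2z-injective {true}  {true}  _ = refl
b2z-injective {false} {true}  ()
b2z-injective {true}  {false} ()

Extensional : ∀ {n} → BoolFun n → Set
Extensional h = ∀ {x x′} → (∀ i → x i ≡ x′ i) → h x ≡ h x′

-- Without function extensionality a Boolean function need not respect
-- pointwise equality of points; a representing polynomial forces it to.
represents⇒extensional : ∀ {n} {c : MultilinearPoly n} {h : BoolFun n} → Represents c h → Extensional h
represents⇒extensional {c = c} c≈h {x} {x′} x≗x′ =
  b2z-injective (trans (sym (c≈h x)) (trans (evalPoly-cong c x≗x′) (c≈h x′)))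

DegreeAtMost : ∀ {n} → MultilinearPoly n → ℕ → Set
DegreeAtMost {n} c q = (V : Subset n) → c V ≢ 0ℤ → ∣ V ∣ ≤ q

*≢0⇒≢0ˡ : ∀ a b → a * b ≢ 0ℤ → a ≢ 0ℤ
*≢0⇒≢0ˡ a b ab≢0 a≡0 = ab≢0 (cong (_* b) a≡0)

*≢0⇒≢0ʳ : ∀ a b → a * b ≢ 0ℤ → b ≢ 0ℤ
*≢0⇒≢0ʳ a b ab≢0 b≡0 = ab≢0 (trans (cong (a *_) b≡0) (ℤ.*-zeroʳ a))

≢0∧≢0⇒*≢0 : ∀ a b → a ≢ 0ℤ → b ≢ 0ℤ → a * b ≢ 0ℤ
≢0∧≢0⇒*≢0 a b a≢0 b≢0 ab≡0 with ℤ.i*j≡0⇒i≡0∨j≡0 a ab≡0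
... | inj₁ a≡0 = a≢0 a≡0
... | inj₂ b≡0 = b≢0 b≡0

one : ∀ {n} → MultilinearPoly n
one []          = 1ℤ
one (false ∷ V) = one V
one (true ∷ V)  = 0ℤ

evalPoly-one : ∀ n (x : Point n) → evalPoly one x ≡ 1ℤ
evalPoly-one zero    x = refl
evalPoly-one (suc n) x = begin
  evalPoly one x
    ≡⟨ ∑-allSubsets-suc n _ ⟩
  ∑[ V ← allSubsets n ] (one V * (1ℤ * monomial V (x ∘ suc))) + ∑[ V ← allSubsets n ] (0ℤ * monomial (true ∷ V) x)
    ≡⟨ cong₂ _+_ (∑-cong (allSubsets n) (λ V → cong (one V *_) (ℤ.*-identityˡ _)))
                 (∑-zero (allSubsets n) (λ _ → refl)) ⟩
  evalPoly one (x ∘ suc) + 0ℤ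
    ≡⟨ cong (_+ 0ℤ) (evalPoly-one n (x ∘ suc)) ⟩
  1ℤ ∎

one-nonempty : ∀ {n} (V : Subset n) → 1 ≤ ∣ V ∣ → one V ≡ 0ℤ
one-nonempty (true ∷ V)  _      = refl
one-nonempty (false ∷ V) 1≤∣V∣ = one-nonempty V 1≤∣V∣

one-∅ : ∀ n → one (∅ {n}) ≡ 1ℤ
one-∅ zero    = refl
one-∅ (suc n) = one-∅ n

one-degree : ∀ {n} → DegreeAtMost (one {n}) 0
one-degree []          _     = z≤n
one-degree (false ∷ V) V≢0   = one-degree V V≢0
one-degree (true ∷ V)  0≢0   = ⊥-elim (0≢0 refl)

negPoly : ∀ {n} → MultilinearPoly n → MultilinearPoly n
negPoly c V = one V - c V

represents-not : ∀ {n} {c : MultilinearPoly n} {h : BoolFun n} → Represents c h → Represents (negPoly c) (not ∘ h)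
represents-not {n} {c} {h} c≈h x = begin
  ∑[ V ← allSubsets n ] ((one V - c V) * monomial V x)
    ≡⟨ ∑-cong (allSubsets n) distrib ⟩
  ∑[ V ← allSubsets n ] (one V * monomial V x + - (c V * monomial V x))
    ≡⟨ ∑-+ (allSubsets n) _ _ ⟩
  evalPoly one x + ∑[ V ← allSubsets n ] (- (c V * monomial V x))
    ≡⟨ cong₂ _+_ (evalPoly-one n x) (trans (∑-neg (allSubsets n) _) (cong -_ (c≈h x))) ⟩
  1ℤ - b2z (h x)
    ≡⟨ one-minus (h x) ⟩
  b2z (not (h x)) ∎
  where
  distrib : ∀ V → (one V - c V) * monomial V x ≡ one V * monomial V x + - (c V * monomial V x)
  distrib V = trans (ℤ.*-distribʳ-+ (monomial V x) (one V) (- c V))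
                    (cong (one V * monomial V x +_) (sym (ℤ.neg-distribˡ-* (c V) (monomial V x))))
  one-minus : ∀ b → 1ℤ - b2z b ≡ b2z (not b)
  one-minus false = refl
  one-minus true  = refl

negPoly-degree : ∀ {n} {c : MultilinearPoly n} {q} → DegreeAtMost c q → DegreeAtMost (negPoly c) q
negPoly-degree {c = c} c≤q V negV≢0 with c V ℤ.≟ 0ℤ
... | no  cV≢0 = c≤q V cV≢0
... | yes cV≡0 = ℕ.≤-trans (one-degree V oneV≢0) z≤n
  where
  oneV≢0 : one V ≢ 0ℤ
  oneV≢0 oneV≡0 = negV≢0 (cong₂ _-_ oneV≡0 cV≡0)

negPoly-nonempty : ∀ {n} (c : MultilinearPoly n) (V : Subset n) → 1 ≤ ∣ V ∣ → c V ≢ 0ℤ → negPoly c V ≢ 0ℤ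
negPoly-nonempty c V 1≤∣V∣ cV≢0 negV≡0 =
  cV≢0 (ℤ.neg-injective (begin
    - c V         ≡⟨ ℤ.+-identityˡ (- c V) ⟨
    0ℤ - c V      ≡⟨ cong (_- c V) (one-nonempty V 1≤∣V∣) ⟨
    negPoly c V   ≡⟨ negV≡0 ⟩
    0ℤ            ∎))

xorPoly : ∀ {n} → Bool → MultilinearPoly n → MultilinearPoly n
xorPoly e c = if e then negPoly c else c

represents-xor : ∀ {n} {c : MultilinearPoly n} {h : BoolFun n} → Represents c h →
  ∀ e → Represents (xorPoly e c) (λ x → h x xor e)
represents-xor {h = h} c≈h true  x = trans (represents-not c≈h x) (cong b2z (sym (xor-comm (h x) true)))
represents-xor {h = h} c≈h false x = trans (c≈h x) (cong b2z (sym (xor-identityʳ (h x))))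

xorPoly-degree : ∀ {n} {c : MultilinearPoly n} {q} e → DegreeAtMost c q → DegreeAtMost (xorPoly e c) q
xorPoly-degree true  = negPoly-degree
xorPoly-degree false c≤q = c≤q

xorPoly-nonempty : ∀ {n} e (c : MultilinearPoly n) (V : Subset n) → 1 ≤ ∣ V ∣ → c V ≢ 0ℤ → xorPoly e c V ≢ 0ℤ
xorPoly-nonempty true  = negPoly-nonempty
xorPoly-nonempty false c V _ cV≢0 = cV≢0

-- Substituting polynomials into disjoint blocks of variables

take-++ : ∀ {A : Set} {m n} (xs : Vec A m) (ys : Vec A n) → take m (xs ++ ys) ≡ xs
take-++ {m = m} xs ys = proj₁ (++-injective (take m (xs ++ ys)) xs (take++drop≡id m (xs ++ ys)))

drop-++ : ∀ {A : Set} {m n} (xs : Vec A m) (ys : Vec A n) → drop m (xs ++ ys) ≡ ys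
drop-++ {m = m} xs ys = proj₂ (++-injective (take m (xs ++ ys)) xs (take++drop≡id m (xs ++ ys)))

∣++∣ : ∀ {m n} (S : Subset m) (T : Subset n) → ∣ S ++ T ∣ ≡ ∣ S ∣ ℕ.+ ∣ T ∣
∣++∣ []          T = refl
∣++∣ (true ∷ S)  T = cong suc (∣++∣ S T)
∣++∣ (false ∷ S) T = ∣++∣ S T

∣W∣≡∣take∣+∣drop∣ : ∀ m {n} (W : Subset (m ℕ.+ n)) → ∣ W ∣ ≡ ∣ take m W ∣ ℕ.+ ∣ drop m W ∣
∣W∣≡∣take∣+∣drop∣ m W = trans (cong ∣_∣ (sym (take++drop≡id m W))) (∣++∣ (take m W) (drop m W))

monomial-++ : ∀ {m n} (S : Subset m) (T : Subset n) (x : Point (m ℕ.+ n)) →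
  monomial (S ++ T) x ≡ monomial S (x ∘ (_↑ˡ n)) * monomial T (x ∘ (m ↑ʳ_))
monomial-++ []      T x = sym (ℤ.*-identityˡ _)
monomial-++ {suc m} {n} (b ∷ S) T x =
  trans (cong (xᵇ *_) (monomial-++ S T (x ∘ suc)))
        (sym (ℤ.*-assoc xᵇ (monomial S (x ∘ suc ∘ (_↑ˡ n))) (monomial T (x ∘ suc ∘ (m ↑ʳ_)))))
  where
  xᵇ : ℤ
  xᵇ = if b then b2z (x zero) else 1ℤ

_⊗_ : ∀ {m n} → MultilinearPoly m → MultilinearPoly n → MultilinearPoly (m ℕ.+ n)
_⊗_ {m} c c′ W = c (take m W) * c′ (drop m W)

⊗-++ : ∀ {m n} (c : MultilinearPoly m) (c′ : MultilinearPoly n) S T → (c ⊗ c′) (S ++ T) ≡ c S * c′ T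
⊗-++ c c′ S T = cong₂ (λ S′ T′ → c S′ * c′ T′) (take-++ S T) (drop-++ S T)

⊗-++≢0 : ∀ {m n} (c : MultilinearPoly m) (c′ : MultilinearPoly n) S T →
  (c ⊗ c′) (S ++ T) ≢ 0ℤ → c S ≢ 0ℤ × c′ T ≢ 0ℤ
⊗-++≢0 c c′ S T ≢0 = *≢0⇒≢0ˡ (c S) (c′ T) product≢0 , *≢0⇒≢0ʳ (c S) (c′ T) product≢0
  where
  product≢0 : c S * c′ T ≢ 0ℤ
  product≢0 = ≢0 ∘ trans (⊗-++ c c′ S T)

evalPoly-⊗ : ∀ {m n} (c : MultilinearPoly m) (c′ : MultilinearPoly n) (x : Point (m ℕ.+ n)) →
  evalPoly (c ⊗ c′) x ≡ evalPoly c (x ∘ (_↑ˡ n)) * evalPoly c′ (x ∘ (m ↑ʳ_))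
evalPoly-⊗ {m} {n} c c′ x = begin
  evalPoly (c ⊗ c′) x
    ≡⟨ ∑-allSubsets-++ m n _ ⟩
  ∑[ S ← allSubsets m ] ∑[ T ← allSubsets n ] ((c ⊗ c′) (S ++ T) * monomial (S ++ T) x)
    ≡⟨ ∑-cong (allSubsets m) (λ S → ∑-cong (allSubsets n) (separate S)) ⟩
  ∑[ S ← allSubsets m ] ∑[ T ← allSubsets n ] (term c xˡ S * term c′ xʳ T)
    ≡⟨ ∑-cong (allSubsets m) (λ S → ∑-*ˡ (allSubsets n) (term c xˡ S) (term c′ xʳ)) ⟩
  ∑[ S ← allSubsets m ] (term c xˡ S * evalPoly c′ xʳ)
    ≡⟨ ∑-*ʳ (allSubsets m) (evalPoly c′ xʳ) (term c xˡ) ⟩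
  evalPoly c xˡ * evalPoly c′ xʳ ∎
  where
  xˡ : Point m
  xˡ = x ∘ (_↑ˡ n)
  xʳ : Point n
  xʳ = x ∘ (m ↑ʳ_)
  term : ∀ {k} → MultilinearPoly k → Point k → Subset k → ℤ
  term c x S = c S * monomial S x
  separate : ∀ S T → (c ⊗ c′) (S ++ T) * monomial (S ++ T) x ≡ term c xˡ S * term c′ xʳ T
  separate S T = trans (cong₂ _*_ (⊗-++ c c′ S T) (monomial-++ S T x))
                       (interchange ℤ.*-commutativeSemigroup (c S) (c′ T) _ _)

⊗-degree : ∀ {m n} {c : MultilinearPoly m} {c′ : MultilinearPoly n} {a b} →
  DegreeAtMost c a → DegreeAtMost c′ b → DegreeAtMost (c ⊗ c′) (a ℕ.+ b)
⊗-degree {m} {c = c} {c′} c≤a c′≤b W W≢0 =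
  ℕ.≤-trans (ℕ.≤-reflexive (∣W∣≡∣take∣+∣drop∣ m W))
            (ℕ.+-mono-≤ (c≤a (take m W) (*≢0⇒≢0ˡ _ _ W≢0)) (c′≤b (drop m W) (*≢0⇒≢0ʳ (c (take m W)) _ W≢0)))

blockCompose : ∀ {d m} → BoolFun d → (Fin d → BoolFun m) → BoolFun (d ℕ.* m)
blockCompose f a x = f (λ j → a j (x ∘ combine j))

blockProduct : ∀ {d m} → (Fin d → MultilinearPoly m) → Subset d → MultilinearPoly (d ℕ.* m)
blockProduct {zero}  A []      = one
blockProduct {suc d} A (r ∷ R) = (if r then A zero else one) ⊗ blockProduct (A ∘ suc) R

substitute : ∀ {d m} → MultilinearPoly d → (Fin d → MultilinearPoly m) → MultilinearPoly (d ℕ.* m)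
substitute {d} F A W = ∑[ R ← allSubsets d ] (F R * blockProduct A R W)

evalPoly-blockProduct : ∀ {d m} {A : Fin d → MultilinearPoly m} {a : Fin d → BoolFun m} →
  (∀ j → Represents (A j) (a j)) →
  ∀ R x → evalPoly (blockProduct A R) x ≡ monomial R (λ j → a j (x ∘ combine j))
evalPoly-blockProduct {zero}          A≈a []      x = refl
evalPoly-blockProduct {suc d} {m} {A} {a} A≈a (r ∷ R) x =
  trans (evalPoly-⊗ (if r then A zero else one) (blockProduct (A ∘ suc) R) x)
        (cong₂ _*_ (factor r) (evalPoly-blockProduct (A≈a ∘ suc) R (x ∘ (m ↑ʳ_))))
  where
  x₀ : Point m
  x₀ = x ∘ combine {suc d} zero
  factor : ∀ r → evalPoly (if r then A zero else one) x₀ ≡ (if r then b2z (a zero x₀) else 1ℤ)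
  factor true  = A≈a zero _
  factor false = evalPoly-one m _

evalPoly-∑ : ∀ {n} {I : Set} (is : List I) (F : I → ℤ) (P : I → MultilinearPoly n) (x : Point n) →
  evalPoly (λ W → ∑[ i ← is ] (F i * P i W)) x ≡ ∑[ i ← is ] (F i * evalPoly (P i) x)
evalPoly-∑ {n} is F P x = begin
  ∑[ W ← allSubsets n ] (∑[ i ← is ] (F i * P i W) * monomial W x)
    ≡⟨ ∑-cong (allSubsets n) (λ W → ∑-*ʳ is (monomial W x) (λ i → F i * P i W)) ⟨
  ∑[ W ← allSubsets n ] ∑[ i ← is ] (F i * P i W * monomial W x)
    ≡⟨ ∑-comm (allSubsets n) is _ ⟩
  ∑[ i ← is ] ∑[ W ← allSubsets n ] (F i * P i W * monomial W x)
    ≡⟨ ∑-cong is (λ i → trans (∑-cong (allSubsets n) (λ W → ℤ.*-assoc (F i) _ _))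
                               (∑-*ˡ (allSubsets n) (F i) _)) ⟩
  ∑[ i ← is ] (F i * evalPoly (P i) x) ∎

represents-substitute : ∀ {d m} {F : MultilinearPoly d} {f : BoolFun d}
  {A : Fin d → MultilinearPoly m} {a : Fin d → BoolFun m} →
  Represents F f → (∀ j → Represents (A j) (a j)) → Represents (substitute F A) (blockCompose f a)
represents-substitute {d} {F = F} {f} {A} {a} F≈f A≈a x = begin
  evalPoly (substitute F A) x
    ≡⟨ evalPoly-∑ (allSubsets d) F (blockProduct A) x ⟩
  ∑[ R ← allSubsets d ] (F R * evalPoly (blockProduct A R) x)
    ≡⟨ ∑-cong (allSubsets d) (λ R → cong (F R *_) (evalPoly-blockProduct A≈a R x)) ⟩
  evalPoly F (λ j → a j (x ∘ combine j))
    ≡⟨ F≈f _ ⟩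
  b2z (blockCompose f a x) ∎

blockProduct-degree : ∀ {d m} {A : Fin d → MultilinearPoly m} {q} →
  (∀ j → DegreeAtMost (A j) q) → ∀ R → DegreeAtMost (blockProduct A R) (∣ R ∣ ℕ.* q)
blockProduct-degree A≤q []          = one-degree
blockProduct-degree A≤q (true ∷ R)  = ⊗-degree (A≤q zero) (blockProduct-degree (A≤q ∘ suc) R)
blockProduct-degree A≤q (false ∷ R) = ⊗-degree one-degree (blockProduct-degree (A≤q ∘ suc) R)

substitute-degree : ∀ {d m} {F : MultilinearPoly d} {A : Fin d → MultilinearPoly m} {p q} →
  DegreeAtMost F p → (∀ j → DegreeAtMost (A j) q) → DegreeAtMost (substitute F A) (p ℕ.* q)
substitute-degree {d} {F = F} {A} {q = q} F≤p A≤q W W≢0 =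
  let R , term≢0 = ∑≢0⇒∃≢0 (allSubsets d) _ W≢0 in
  ℕ.≤-trans (blockProduct-degree A≤q R W (*≢0⇒≢0ʳ (F R) _ term≢0))
            (ℕ.*-monoˡ-≤ q (F≤p R (*≢0⇒≢0ˡ _ (blockProduct A R W) term≢0)))

p⊆q∧∣q∣≤∣p∣⇒p≡q : ∀ {n} {p q : Subset n} → p ⊆ q → ∣ q ∣ ≤ ∣ p ∣ → p ≡ q
p⊆q∧∣q∣≤∣p∣⇒p≡q {p = []}          {[]}          _   _ = refl
p⊆q∧∣q∣≤∣p∣⇒p≡q {p = outside ∷ p} {outside ∷ q} p⊆q q≤p =
  cong (outside ∷_) (p⊆q∧∣q∣≤∣p∣⇒p≡q (drop-∷-⊆ p⊆q) q≤p)
p⊆q∧∣q∣≤∣p∣⇒p≡q {p = outside ∷ p} {inside ∷ q}  p⊆q q≤p =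
  contradiction q≤p (ℕ.<⇒≱ (s≤s (p⊆q⇒∣p∣≤∣q∣ (drop-∷-⊆ p⊆q))))
p⊆q∧∣q∣≤∣p∣⇒p≡q {p = inside ∷ p}  {outside ∷ q} p⊆q _ = contradiction (p⊆q here) λ ()
p⊆q∧∣q∣≤∣p∣⇒p≡q {p = inside ∷ p}  {inside ∷ q}  p⊆q (s≤s q≤p) =
  cong (inside ∷_) (p⊆q∧∣q∣≤∣p∣⇒p≡q (drop-∷-⊆ p⊆q) q≤p)

x∈p⇒1≤∣p∣ : ∀ {n} {x : Fin n} {p : Subset n} → x ∈ p → 1 ≤ ∣ p ∣
x∈p⇒1≤∣p∣ x∈p = ℕ.≤-trans (s≤s z≤n) (x∈p⇒∣p-x∣<∣p∣ x∈p)

spread : ∀ {d m} → Subset d → Subset m → Subset (d ℕ.* m)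
spread []      U = []
spread (r ∷ R) U = (if r then U else ∅) ++ spread R U

∣spread∣ : ∀ {d m} (R : Subset d) (U : Subset m) → ∣ spread R U ∣ ≡ ∣ R ∣ ℕ.* ∣ U ∣
∣spread∣           []          U = refl
∣spread∣           (true ∷ R)  U = trans (∣++∣ U (spread R U)) (cong (∣ U ∣ ℕ.+_) (∣spread∣ R U))
∣spread∣ {suc d} {m} (false ∷ R) U =
  trans (∣++∣ (∅ {m}) (spread R U)) (cong₂ ℕ._+_ (∣⊥∣≡0 m) (∣spread∣ R U))

blockProduct-spread≢0⇒⊆ : ∀ {d m} (A : Fin d → MultilinearPoly m) (U : Subset m) {R* R : Subset d} →
  (1 ≤ ∣ R* ∣ → 1 ≤ ∣ U ∣) → blockProduct A R (spread R* U) ≢ 0ℤ → R* ⊆ R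
blockProduct-spread≢0⇒⊆ {zero} A U {[]} {[]} _ _ ()
blockProduct-spread≢0⇒⊆ {suc d} A U {true ∷ R*} {false ∷ R} U≢∅ P≢0 =
  ⊥-elim (proj₁ (⊗-++≢0 one (blockProduct (A ∘ suc) R) U (spread R* U) P≢0) (one-nonempty U (U≢∅ (s≤s z≤n))))
blockProduct-spread≢0⇒⊆ {suc d} A U {true ∷ R*} {true ∷ R} U≢∅ P≢0 =
  s⊆s (blockProduct-spread≢0⇒⊆ (A ∘ suc) U (U≢∅ ∘ ℕ.m≤n⇒m≤1+n)
        (proj₂ (⊗-++≢0 (A zero) (blockProduct (A ∘ suc) R) U (spread R* U) P≢0)))
blockProduct-spread≢0⇒⊆ {suc d} {m} A U {false ∷ R*} {r ∷ R} U≢∅ P≢0 =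
  out⊆ (blockProduct-spread≢0⇒⊆ (A ∘ suc) U U≢∅
        (proj₂ (⊗-++≢0 (if r then A zero else one) (blockProduct (A ∘ suc) R) (∅ {m}) (spread R* U) P≢0)))

blockProduct-spread≢0 : ∀ {d m} (A : Fin d → MultilinearPoly m) (U : Subset m) (R : Subset d) →
  (∀ {j} → j ∈ R → A j U ≢ 0ℤ) → blockProduct A R (spread R U) ≢ 0ℤ
blockProduct-spread≢0 {zero} A U [] _ ()
blockProduct-spread≢0 {suc d} A U (true ∷ R) AU≢0 P≡0 =
  ≢0∧≢0⇒*≢0 _ _ (AU≢0 here) (blockProduct-spread≢0 (A ∘ suc) U R (AU≢0 ∘ there))
    (trans (sym (⊗-++ (A zero) (blockProduct (A ∘ suc) R) U (spread R U))) P≡0)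
blockProduct-spread≢0 {suc d} {m} A U (false ∷ R) AU≢0 P≡0 =
  ≢0∧≢0⇒*≢0 _ _ (λ one∅≡0 → 1≢0 (trans (sym (one-∅ m)) one∅≡0))
                (blockProduct-spread≢0 (A ∘ suc) U R (AU≢0 ∘ there))
    (trans (sym (⊗-++ one (blockProduct (A ∘ suc) R) (∅ {m}) (spread R U))) P≡0)
  where
  1≢0 : 1ℤ ≢ 0ℤ
  1≢0 ()

substitute-spread≢0 : ∀ {d m} (F : MultilinearPoly d) (A : Fin d → MultilinearPoly m) (U : Subset m) (R* : Subset d) →
  F R* ≢ 0ℤ → (∀ R → F R ≢ 0ℤ → ∣ R ∣ ≤ ∣ R* ∣) →
  (1 ≤ ∣ R* ∣ → 1 ≤ ∣ U ∣) → (∀ {j} → j ∈ R* → A j U ≢ 0ℤ) → substitute F A (spread R* U) ≢ 0ℤ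
substitute-spread≢0 {d} F A U R* FR*≢0 R*-top U≢∅ AU≢0 =
  subst (_≢ 0ℤ) (sym (∑-allSubsets-single d _ R* others))
        (≢0∧≢0⇒*≢0 (F R*) _ FR*≢0 (blockProduct-spread≢0 A U R* AU≢0))
  where
  others : ∀ R → R ≢ R* → F R * blockProduct A R (spread R* U) ≡ 0ℤ
  others R R≢R* with F R ℤ.≟ 0ℤ | blockProduct A R (spread R* U) ℤ.≟ 0ℤ
  ... | yes FR≡0 | _       = cong (_* blockProduct A R (spread R* U)) FR≡0
  ... | no _     | yes P≡0 = trans (cong (F R *_) P≡0) (ℤ.*-zeroʳ (F R))
  ... | no FR≢0  | no P≢0  =
    contradiction (sym (p⊆q∧∣q∣≤∣p∣⇒p≡q (blockProduct-spread≢0⇒⊆ A U U≢∅ P≢0) (R*-top R FR≢0))) R≢R*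

-- The condition on U is only needed for nonconstant F: for p = 0 the top
-- monomial of the substitution is the empty one.
substitute-polyDegree : ∀ {d m} {F : MultilinearPoly d} {A : Fin d → MultilinearPoly m} {p q} →
  PolyDegree F p → (∀ j → DegreeAtMost (A j) q) →
  (U : Subset m) → ∣ U ∣ ≡ q → (1 ≤ p → 1 ≤ q × (∀ j → A j U ≢ 0ℤ)) →
  PolyDegree (substitute F A) (p ℕ.* q)
substitute-polyDegree {F = F} {A} {q = q} (F≤p , R* , FR*≢0 , ∣R*∣≡p) A≤q U ∣U∣≡q top =
  substitute-degree F≤p A≤q ,
  spread R* U ,
  substitute-spread≢0 F A U R* FR*≢0 (λ R → subst (∣ R ∣ ≤_) (sym ∣R*∣≡p) ∘ F≤p R) U≢∅ AU≢0 ,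
  trans (∣spread∣ R* U) (cong₂ ℕ._*_ ∣R*∣≡p ∣U∣≡q)
  where
  top* : 1 ≤ ∣ R* ∣ → 1 ≤ q × (∀ j → A j U ≢ 0ℤ)
  top* = top ∘ subst (1 ≤_) ∣R*∣≡p
  U≢∅ : 1 ≤ ∣ R* ∣ → 1 ≤ ∣ U ∣
  U≢∅ = subst (1 ≤_) (sym ∣U∣≡q) ∘ proj₁ ∘ top*
  AU≢0 : ∀ {j} → j ∈ R* → A j U ≢ 0ℤ
  AU≢0 {j} j∈R* = proj₂ (top* (x∈p⇒1≤∣p∣ j∈R*)) j

-- Sensitivity of block compositions

nonempty : ∀ {n} → Subset n → Bool
nonempty []      = false
nonempty (b ∷ S) = b ∨ nonempty S

nonempty-false : ∀ {n} (S : Subset n) → nonempty S ≡ false → S ≡ ∅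
nonempty-false []          _ = refl
nonempty-false (false ∷ S) e = cong (false ∷_) (nonempty-false S e)
nonempty-false (true ∷ S)  ()

nonempty-true : ∀ {n} (S : Subset n) → nonempty S ≡ true → 1 ≤ ∣ S ∣
nonempty-true (true ∷ S)  _ = s≤s z≤n
nonempty-true (false ∷ S) e = nonempty-true S e

nonempty-∅ : ∀ n → nonempty (∅ {n}) ≡ false
nonempty-∅ zero    = refl
nonempty-∅ (suc n) = nonempty-∅ n

flipAt-∅ : ∀ {n} (x : Point n) i → flipAt ∅ x i ≡ x i
flipAt-∅ x i = trans (cong (x i xor_) (lookup-replicate i false)) (xor-identityʳ (x i))

KSensitive⇒flipAt-xor : ∀ {n k} {h : BoolFun n} {x : Point n} → Extensional h → KSensitive k h x →
  ∀ V → ∣ V ∣ ≤ k → h (flipAt V x) xor h x ≡ nonempty V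
KSensitive⇒flipAt-xor {h = h} {x} h-ext h-sens V ∣V∣≤k with nonempty V in eq
... | false = trans (cong (_xor h x) (h-ext unflipped)) (xor-same (h x))
  where
  unflipped : ∀ i → flipAt V x i ≡ x i
  unflipped i = trans (cong (λ W → flipAt W x i) (nonempty-false V eq)) (flipAt-∅ x i)
... | true  = trans (cong (_xor h x) (¬-not (h-sens V (nonempty-true V eq) ∣V∣≤k ∘ sym))) (xor-inverseˡ (h x))

block : ∀ {d m} → Subset (d ℕ.* m) → Fin d → Subset m
block {suc d} {m} S zero    = take m S
block {suc d} {m} S (suc j) = block {d} (drop m S) j

touched : ∀ {d m} → Subset (d ℕ.* m) → Subset d
touched {zero}      S = []
touched {suc d} {m} S = nonempty (take m S) ∷ touched {d} (drop m S)

lookup-combine : ∀ {d m} (S : Subset (d ℕ.* m)) j t → lookup S (combine j t) ≡ lookup (block {d} {m} S j) t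
lookup-combine {suc d} {m} S zero    t = begin
  lookup S (t ↑ˡ d ℕ.* m)                       ≡⟨ cong (λ S′ → lookup S′ (t ↑ˡ d ℕ.* m)) (take++drop≡id m S) ⟨
  lookup (take m S ++ drop m S) (t ↑ˡ d ℕ.* m)  ≡⟨ lookup-++ˡ (take m S) (drop m S) t ⟩
  lookup (take m S) t                           ∎
lookup-combine {suc d} {m} S (suc j) t = begin
  lookup S (m ↑ʳ combine j t)                       ≡⟨ cong (λ S′ → lookup S′ (m ↑ʳ combine j t)) (take++drop≡id m S) ⟨
  lookup (take m S ++ drop m S) (m ↑ʳ combine j t)  ≡⟨ lookup-++ʳ (take m S) (drop m S) (combine j t) ⟩
  lookup (drop m S) (combine j t)                   ≡⟨ lookup-combine {d} (drop m S) j t ⟩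
  lookup (block {suc d} S (suc j)) t                ∎

lookup-touched : ∀ {d m} (S : Subset (d ℕ.* m)) j → lookup (touched {d} {m} S) j ≡ nonempty (block {d} {m} S j)
lookup-touched {suc d}     S zero    = refl
lookup-touched {suc d} {m} S (suc j) = lookup-touched {d} (drop m S) j

∣block∣≤∣S∣ : ∀ {d m} (S : Subset (d ℕ.* m)) j → ∣ block {d} {m} S j ∣ ≤ ∣ S ∣
∣block∣≤∣S∣ {zero}      S ()
∣block∣≤∣S∣ {suc d} {m} S j = ℕ.≤-trans (≤take+drop j) (ℕ.≤-reflexive (sym (∣W∣≡∣take∣+∣drop∣ m S)))
  where
  ≤take+drop : ∀ j → ∣ block {suc d} S j ∣ ≤ ∣ take m S ∣ ℕ.+ ∣ drop m S ∣
  ≤take+drop zero    = ℕ.m≤m+n _ _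
  ≤take+drop (suc j) = ℕ.≤-trans (∣block∣≤∣S∣ {d} (drop m S) j) (ℕ.m≤n+m _ _)

∣touched∣≤∣S∣ : ∀ {d m} (S : Subset (d ℕ.* m)) → ∣ touched {d} {m} S ∣ ≤ ∣ S ∣
∣touched∣≤∣S∣ {zero}      S = z≤n
∣touched∣≤∣S∣ {suc d} {m} S =
  ℕ.≤-trans (≤take+drop (nonempty (take m S)) refl) (ℕ.≤-reflexive (sym (∣W∣≡∣take∣+∣drop∣ m S)))
  where
  ≤take+drop : ∀ b → nonempty (take m S) ≡ b →
    ∣ b ∷ touched {d} (drop m S) ∣ ≤ ∣ take m S ∣ ℕ.+ ∣ drop m S ∣
  ≤take+drop true  eq = ℕ.+-mono-≤ (nonempty-true (take m S) eq) (∣touched∣≤∣S∣ {d} (drop m S))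
  ≤take+drop false _  = ℕ.≤-trans (∣touched∣≤∣S∣ {d} (drop m S)) (ℕ.m≤n+m _ _)

touched-nonempty : ∀ {d m} (S : Subset (d ℕ.* m)) → 1 ≤ ∣ S ∣ → 1 ≤ ∣ touched {d} {m} S ∣
touched-nonempty {zero}      [] ()
touched-nonempty {suc d} {m} S 1≤∣S∣ with nonempty (take m S) in eq
... | true  = s≤s z≤n
... | false = touched-nonempty {d} (drop m S) (subst (1 ≤_) ∣S∣≡∣drop∣ 1≤∣S∣)
  where
  ∣S∣≡∣drop∣ : ∣ S ∣ ≡ ∣ drop m S ∣
  ∣S∣≡∣drop∣ = trans (∣W∣≡∣take∣+∣drop∣ m S)
                     (cong (ℕ._+ ∣ drop m S ∣) (trans (cong ∣_∣ (nonempty-false (take m S) eq)) (∣⊥∣≡0 m)))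

blockCompose-sensitive : ∀ {d m k} {f : BoolFun d} {y : Point d} {a : Fin d → BoolFun m} (Y : Point (d ℕ.* m)) →
  Extensional f → KSensitive k f y → (∀ j → Extensional (a j)) →
  (∀ j (V : Subset m) → ∣ V ∣ ≤ k → a j (flipAt V (Y ∘ combine j)) ≡ y j xor nonempty V) →
  KSensitive k (blockCompose f a) Y
blockCompose-sensitive {d} {m} {k} {f} {y} {a} Y f-ext f-sens a-ext a-flip S 1≤∣S∣ ∣S∣≤k fY≡fSY =
  f-sens T (touched-nonempty {d} S 1≤∣S∣) (ℕ.≤-trans (∣touched∣≤∣S∣ {d} S) ∣S∣≤k) (begin
    f y                               ≡⟨ unflipped ⟨
    blockCompose f a Y                ≡⟨ fY≡fSY ⟩
    blockCompose f a (flipAt S Y)     ≡⟨ flipped ⟩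
    f (flipAt T y)                    ∎)
  where
  T : Subset d
  T = touched {d} {m} S
  unflipped : blockCompose f a Y ≡ f y
  unflipped = f-ext λ j → begin
    a j (Y ∘ combine j)             ≡⟨ a-ext j (sym ∘ flipAt-∅ (Y ∘ combine j)) ⟩
    a j (flipAt ∅ (Y ∘ combine j))  ≡⟨ a-flip j ∅ (ℕ.≤-trans (ℕ.≤-reflexive (∣⊥∣≡0 m)) z≤n) ⟩
    y j xor nonempty (∅ {m})        ≡⟨ cong (y j xor_) (nonempty-∅ m) ⟩
    y j xor false                   ≡⟨ xor-identityʳ (y j) ⟩
    y j                             ∎
  flipped : blockCompose f a (flipAt S Y) ≡ f (flipAt T y)
  flipped = f-ext λ j → begin
    a j (flipAt S Y ∘ combine j)              ≡⟨ a-ext j (λ t → cong (Y (combine j t) xor_) (lookup-combine S j t)) ⟩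
    a j (flipAt (block S j) (Y ∘ combine j))  ≡⟨ a-flip j (block S j) (ℕ.≤-trans (∣block∣≤∣S∣ S j) ∣S∣≤k) ⟩
    y j xor nonempty (block S j)              ≡⟨ cong (y j xor_) (lookup-touched S j) ⟨
    flipAt T y j                              ∎

var₀ : MultilinearPoly 1
var₀ (false ∷ []) = 0ℤ
var₀ (true ∷ [])  = 1ℤ

represents-var₀ : Represents var₀ (λ x → x zero)
represents-var₀ x with x zero
... | false = refl
... | true  = refl

var₀-degree : DegreeAtMost var₀ 1
var₀-degree (false ∷ []) _ = z≤n
var₀-degree (true ∷ [])  _ = s≤s z≤n

module Iteration {d k p} {f : BoolFun d} {y : Point d} (f-sens : KSensitive k f y)
                 {F : MultilinearPoly d} (F≈f : Represents F f) (F-deg : PolyDegree F p) where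

  f-ext : Extensional f
  f-ext = represents⇒extensional {c = F} F≈f

  fIter-one : KSensitive k (fIter f y 1) (yIter y 1) × PDeg (fIter f y 1) (p ^ 1)
  fIter-one =
    blockCompose-sensitive (yIter y 1) f-ext f-sens (λ _ x≗x′ → x≗x′ zero) flip-bit ,
    substitute F (λ _ → var₀) ,
    represents-substitute {F = F} {A = λ _ → var₀} F≈f (λ _ → represents-var₀) ,
    substitute-polyDegree F-deg (λ _ → var₀-degree) (true ∷ []) refl (λ _ → s≤s z≤n , λ _ ())
    where
    flip-bit : ∀ j (V : Subset 1) → ∣ V ∣ ≤ k → flipAt V (yIter y 1 ∘ combine j) zero ≡ y j xor nonempty V
    flip-bit j (b ∷ []) _ = cong₂ _xor_ (cong (y ∘ proj₁) (remQuot-combine j zero)) (sym (∨-identityʳ b))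

  module Step (i : ℕ) {cG : MultilinearPoly (d ^ suc i)} (cG≈G : Represents cG (fIter f y (suc i))) where

    G : BoolFun (d ^ suc i)
    G = fIter f y (suc i)

    Y : Point (d ^ suc i)
    Y = yIter y (suc i)

    c₀ : Bool
    c₀ = G Y

    a : Fin d → BoolFun (d ^ suc i)
    a j x = (G x xor c₀) xor y j

    A : Fin d → MultilinearPoly (d ^ suc i)
    A j = xorPoly (c₀ xor y j) cG

    A≈a : ∀ j → Represents (A j) (a j)
    A≈a j x = trans (represents-xor {c = cG} cG≈G (c₀ xor y j) x) (cong b2z (sym (xor-assoc (G x) c₀ (y j))))

    G-ext : Extensional G
    G-ext = represents⇒extensional {c = cG} cG≈G

    sensitive : KSensitive k G Y → KSensitive k (fIter f y (suc (suc i))) (yIter y (suc (suc i)))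
    sensitive G-sens = blockCompose-sensitive (yIter y (suc (suc i))) f-ext f-sens a-ext a-flip
      where
      a-ext : ∀ j → Extensional (a j)
      a-ext j x≗x′ = cong (λ v → (v xor c₀) xor y j) (G-ext x≗x′)
      a-flip : ∀ j (V : Subset (d ^ suc i)) → ∣ V ∣ ≤ k →
        a j (flipAt V (yIter y (suc (suc i)) ∘ combine j)) ≡ y j xor nonempty V
      a-flip j V ∣V∣≤k = begin
        (G (flipAt V (yIter y (suc (suc i)) ∘ combine j)) xor c₀) xor y j
          ≡⟨ cong (λ v → (v xor c₀) xor y j)
                  (G-ext λ t → cong (λ w → Y (proj₂ w) xor lookup V t) (remQuot-combine j t)) ⟩
        (G (flipAt V Y) xor c₀) xor y j
          ≡⟨ cong (_xor y j) (KSensitive⇒flipAt-xor G-ext G-sens V ∣V∣≤k) ⟩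
        nonempty V xor y j
          ≡⟨ xor-comm (nonempty V) (y j) ⟩
        y j xor nonempty V ∎

    pdeg : PolyDegree cG (p ^ suc i) → PDeg (fIter f y (suc (suc i))) (p ^ suc (suc i))
    pdeg (cG≤q , U , cGU≢0 , ∣U∣≡q) =
      substitute F A ,
      represents-substitute {F = F} {A = A} F≈f A≈a ,
      substitute-polyDegree F-deg (λ j → xorPoly-degree (c₀ xor y j) cG≤q) U ∣U∣≡q top
      where
      top : 1 ≤ p → 1 ≤ p ^ suc i × (∀ j → A j U ≢ 0ℤ)
      top 1≤p = 1≤q , λ j → xorPoly-nonempty (c₀ xor y j) cG U (subst (1 ≤_) (sym ∣U∣≡q) 1≤q) cGU≢0
        where
        1≤q : 1 ≤ p ^ suc i
        1≤q = ℕ.m^n>0 p {{ℕ.>-nonZero 1≤p}} (suc i)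

  fIter-suc : ∀ i → KSensitive k (fIter f y (suc i)) (yIter y (suc i)) → PDeg (fIter f y (suc i)) (p ^ suc i) →
    KSensitive k (fIter f y (suc (suc i))) (yIter y (suc (suc i))) × PDeg (fIter f y (suc (suc i))) (p ^ suc (suc i))
  fIter-suc i G-sens (cG , cG≈G , cG-deg) = Step.sensitive i {cG} cG≈G G-sens , Step.pdeg i {cG} cG≈G cG-deg

mainTheorem3 : (d k p : ℕ) (f : BoolFun d) (y : Point d) →
    KSensitive k f y → PDeg f p →
    (u : ℕ) .{{_ : NonZero u}} →
    KSensitive k (fIter f y u) (yIter y u) × PDeg (fIter f y u) (p ^ u)
mainTheorem3 d k p f y f-sens (F , F≈f , F-deg) = iterate
  where
  open Iteration f-sens F≈f F-deg
  iterate : (u : ℕ) .{{_ : NonZero u}} → KSensitive k (fIter f y u) (yIter y u) × PDeg (fIter f y u) (p ^ u)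
  iterate (suc zero)    = fIter-one
  iterate (suc (suc i)) = let G-sens , G-deg = iterate (suc i) in fIter-suc i G-sens G-deg
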